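{- Let $c$ be a positive integer and $k\ge0$ an integer, and set $\sqrt{ -c}:=i\sqrt c$. Let $P_k(X):=(X+\sqrt{ -c})(X-1+\sqrt{ -c})\cdots(X-k+\sqrt{ -c})\in\mathbb{C}[X]$, and for each integer $0\le \ell\le k$ define the rational function $$R_{k,\ell}(z):=\frac{1}{\ell!}\sum_{j=0}^{\ell}(-1)^{\ell-j}\binom{\ell}{j}\frac{1}{P_k(z+j+\sqrt{ -c})}.$$ Let $D:=\mathbb{C}\setminus\{\,j-2\sqrt{ -c}: j\in\mathbb{Z},\ -k\le j\le k\,\}$. Then for every integer $\ell$ with $0\le\ell\le k$ and every $z\in D$, $$R_{k,\ell}(z)=\frac{(-1)^{k+\ell}\binom{k+\ell}{\ell}}{z+2\sqrt{ -c}}\cdot\frac{1}{(k-2\sqrt{ -c}-z)^{\underline{k}}\,(\ell+2\sqrt{ -c}+z)^{\underline{\ell}}}.$$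
   Context: For a complex number (or indeterminate) $X$ and $n\in\mathbb{N}$, $X^{\underline{n}}:=X(X-1)(X-2)\cdots(X-n+1)$ is the falling factorial, with $X^{\underline 0}=1$. -}

module Defs where

open import Level using (Level; _⊔_) renaming (suc to lsuc)
open import Algebra.Bundles using (CommutativeRing)
open import Data.Nat as ℕ using (ℕ; zero; suc)
open import Data.Nat.Combinatorics using (_C_)
open import Data.Nat.Base using (_!)
open import Data.Integer as ℤ using (ℤ; +_; -[1+_])
open import Relation.Nullary using (¬_)

-- A (discrete) field: a commutative ring with 0 ≠ 1 and a total
-- function _⁻¹ that is a right inverse on every nonzero element
-- (its value at 0 is irrelevant: the theorem never inverts 0).
record Field (c ℓ : Level) : Set (lsuc (c ⊔ ℓ)) where
  field
    commutativeRing : CommutativeRing c ℓ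
  open CommutativeRing commutativeRing public
  field
    _⁻¹      : Carrier → Carrier
    0≉1      : ¬ (0# ≈ 1#)
    inverseʳ : ∀ x → ¬ (x ≈ 0#) → x * (x ⁻¹) ≈ 1#

module FieldOps {c ℓ : Level} (F : Field c ℓ) where
  open Field F

  infixl 6 _−_
  _−_ : Carrier → Carrier → Carrier
  x − y = x + (- y)

  ι : ℕ → Carrier
  ι zero    = 0#
  ι (suc n) = 1# + ι n

  ιℤ : ℤ → Carrier
  ιℤ (+ n)     = ι n
  ιℤ -[1+ n ]  = - ι (suc n)

  CharacteristicZero : Set ℓ
  CharacteristicZero = ∀ n → ¬ (ι (suc n) ≈ 0#)

  sgn : ℕ → Carrier
  sgn zero    = 1#
  sgn (suc n) = - sgn n

  Σ≤ : ℕ → (ℕ → Carrier) → Carrier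
  Σ≤ zero    f = f 0
  Σ≤ (suc n) f = Σ≤ n f + f (suc n)

  Π≤ : ℕ → (ℕ → Carrier) → Carrier
  Π≤ zero    f = f 0
  Π≤ (suc n) f = Π≤ n f * f (suc n)

  falling : Carrier → ℕ → Carrier
  falling x zero    = 1#
  falling x (suc n) = falling x n * (x − ι n)

  -- Throughout, w plays the role of √-c.
  module WithRoot (w : Carrier) where

    P : ℕ → Carrier → Carrier
    P k X = Π≤ k (λ m → X − ι m + w)

    R : ℕ → ℕ → Carrier → Carrier
    R k l z = (ι (l !)) ⁻¹ *
      Σ≤ l (λ j → sgn (l ℕ.∸ j) * ι (l C j) * (P k (z + ι j + w)) ⁻¹)

    InD : ℕ → Carrier → Set ℓ
    InD k z = ∀ (j : ℤ) → ℤ.- (+ k) ℤ.≤ j → j ℤ.≤ + k →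
              ¬ (z ≈ ιℤ j − (w + w))

    RHS : ℕ → ℕ → Carrier → Carrier
    RHS k l z =
      (sgn (k ℕ.+ l) * ι ((k ℕ.+ l) C l)) * (z + (w + w)) ⁻¹ *
      (falling (ι k − (w + w) − z) k * falling (ι l + (w + w) + z) l) ⁻¹

module Submission where

-- Write u = z + 2w, where w = √−c.  Since P_k(z + j + w) = (u + j)^{\underline{k+1}}, the sum in
-- R_{k,ℓ}(z) is 1/ℓ! times the ℓ-th forward difference Δ^ℓ a(0) of a(j) = 1/(u + j)^{\underline{k+1}}.
-- Pascal's rule gives Δ^{ℓ+1} a = Δ^ℓ (a ∘ suc) − Δ^ℓ a, and the common denominator
-- Q_ℓ(u) = (u + ℓ)^{\underline{ℓ+k+1}} satisfies both Q_{ℓ+1}(u) = Q_ℓ(u + 1)(u − k) and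
-- Q_{ℓ+1}(u) = (u + ℓ + 1) Q_ℓ(u); so by induction on ℓ,
--   Δ^ℓ a(0) · Q_ℓ(u) = (−1)^ℓ ℓ! C(k+ℓ, ℓ),
-- the factor u − k − (u + ℓ + 1) = −(k + ℓ + 1) appearing at each step.  Finally
-- Q_ℓ(u) = (u + ℓ)^{\underline ℓ} · u · (u − 1)^{\underline k} and (u − 1)^{\underline k} = (−1)^k (k − u)^{\underline k}.

open import Defs
open import Level using (Level)
open import Data.Nat as ℕ using (ℕ; zero; suc; _≤_; _<_; z≤n; s≤s; _!; NonZero)
import Data.Nat.Properties as ℕₚ
open import Data.Nat.Combinatorics using (_C_; nCk+nC[k+1]≡[n+1]C[k+1]; k![n∸k]!∣n!)
open import Data.Nat.Combinatorics.Specification using (k>n⇒nCk≡0; nCk≡n!/k![n-k]!)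
open import Data.Nat.DivMod using (_/_; m/n*n≡m)
open import Data.Integer as ℤ using (ℤ; +_; -[1+_]; _⊖_)
import Data.Integer.Properties as ℤₚ
open import Data.Sign as Sign using (Sign)
open import Data.Maybe using (Maybe; just; nothing)
open import Function using (_∘_; id)
open import Relation.Nullary using (yes; no)
open import Relation.Binary.PropositionalEquality as ≡ using (_≡_)
open import Algebra.Solver.Ring.AlmostCommutativeRing using (_-Raw-AlmostCommutative⟶_; fromCommutativeRing)

module _ where
  open import Data.Nat using (_+_; _*_; _∸_)
  open ≡.≡-Reasoning

  [k+l]Cl*l!*k!≡[k+l]! : ∀ k l → ((k + l) C l) * l ! * k ! ≡ (k + l) !
  [k+l]Cl*l!*k!≡[k+l]! k l = begin
    ((k + l) C l) * l ! * k !
      ≡⟨ ℕₚ.*-assoc ((k + l) C l) (l !) (k !) ⟩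
    ((k + l) C l) * (l ! * k !)
      ≡⟨ ≡.cong (λ t → ((k + l) C l) * (l ! * t !)) (≡.sym (ℕₚ.m+n∸n≡m k l)) ⟩
    ((k + l) C l) * (l ! * (k + l ∸ l) !)
      ≡⟨ ≡.cong (_* (l ! * (k + l ∸ l) !)) (nCk≡n!/k![n-k]! l≤k+l) ⟩
    (k + l) ! / (l ! * (k + l ∸ l) !) * (l ! * (k + l ∸ l) !)
      ≡⟨ m/n*n≡m (k![n∸k]!∣n! l≤k+l) ⟩
    (k + l) !
      ∎
    where
    l≤k+l : l ≤ k + l
    l≤k+l = ℕₚ.m≤n+m l k
    instance
      l![k+l∸l]!≢0 : NonZero (l ! * (k + l ∸ l) !)
      l![k+l∸l]!≢0 = ℕₚ._!*_!≢0 l (k + l ∸ l)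

  [k+l]Cl*l!-suc : ∀ k l → ((k + suc l) C suc l) * suc l ! ≡ (k + suc l) * (((k + l) C l) * l !)
  [k+l]Cl*l!-suc k l = ℕₚ.*-cancelʳ-≡ _ _ (k !) {{ℕₚ._!≢0 k}} (begin
    ((k + suc l) C suc l) * suc l ! * k !
      ≡⟨ [k+l]Cl*l!*k!≡[k+l]! k (suc l) ⟩
    (k + suc l) !
      ≡⟨ ≡.cong _! (ℕₚ.+-suc k l) ⟩
    suc (k + l) * (k + l) !
      ≡⟨ ≡.cong (suc (k + l) *_) (≡.sym ([k+l]Cl*l!*k!≡[k+l]! k l)) ⟩
    suc (k + l) * (((k + l) C l) * l ! * k !)
      ≡⟨ ≡.sym (ℕₚ.*-assoc (suc (k + l)) (((k + l) C l) * l !) (k !)) ⟩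
    suc (k + l) * (((k + l) C l) * l !) * k !
      ≡⟨ ≡.cong (λ t → t * (((k + l) C l) * l !) * k !) (≡.sym (ℕₚ.+-suc k l)) ⟩
    (k + suc l) * (((k + l) C l) * l !) * k !
      ∎)

-[k]≤m⊖n : ∀ {k n} m → n ≤ k → ℤ.- (+ k) ℤ.≤ m ⊖ n
-[k]≤m⊖n {k} {n} m n≤k = begin
  ℤ.- (+ k)  ≡⟨ -[n]≡0⊖n k ⟩
  0 ⊖ k      ≤⟨ ℤₚ.⊖-monoʳ-≥-≤ 0 n≤k ⟩
  0 ⊖ n      ≤⟨ ℤₚ.⊖-monoˡ-≤ n z≤n ⟩
  m ⊖ n      ∎
  where
  open ℤₚ.≤-Reasoning
  -[n]≡0⊖n : ∀ n → ℤ.- (+ n) ≡ 0 ⊖ n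
  -[n]≡0⊖n zero    = ≡.refl
  -[n]≡0⊖n (suc n) = ≡.refl

m⊖n≤k : ∀ {k m} n → m ≤ k → m ⊖ n ℤ.≤ + k
m⊖n≤k {m = m} n m≤k = ℤₚ.≤-trans (ℤₚ.m⊖n≤m m n) (ℤ.+≤+ m≤k)

module _ {a b : Level} (F : Field a b) where
  open Field F
  open FieldOps F
  open import Algebra.Properties.Ring ring using (-‿distribˡ-*; -‿distribʳ-*; [y-z]x≈yx-zx)
  open import Algebra.Properties.AbelianGroup +-abelianGroup using (⁻¹-∙-comm; ε⁻¹≈ε; ⁻¹-involutive)
  open import Algebra.Properties.CommutativeSemigroup *-commutativeSemigroup using (x∙yz≈y∙xz)
  open import Relation.Binary.Reasoning.Setoid setoid

  ι-homo-+ : ∀ m n → ι (m ℕ.+ n) ≈ ι m + ι n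
  ι-homo-+ zero    n = sym (+-identityˡ _)
  ι-homo-+ (suc m) n = trans (+-congˡ (ι-homo-+ m n)) (sym (+-assoc _ _ _))

  ι-homo-* : ∀ m n → ι (m ℕ.* n) ≈ ι m * ι n
  ι-homo-* zero    n = sym (zeroˡ _)
  ι-homo-* (suc m) n = begin
    ι (n ℕ.+ m ℕ.* n)     ≈⟨ ι-homo-+ n (m ℕ.* n) ⟩
    ι n + ι (m ℕ.* n)     ≈⟨ +-cong (sym (*-identityˡ _)) (ι-homo-* m n) ⟩
    1# * ι n + ι m * ι n  ≈⟨ sym (distribʳ _ _ _) ⟩
    (1# + ι m) * ι n      ∎

  ι-homo-∸ : ∀ {m n} → n ≤ m → ι (m ℕ.∸ n) ≈ ι m − ι n
  ι-homo-∸ {m} {n} n≤m = begin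
    ι (m ℕ.∸ n)                  ≈⟨ sym (+-identityʳ _) ⟩
    ι (m ℕ.∸ n) + 0#             ≈⟨ +-congˡ (sym (-‿inverseʳ (ι n))) ⟩
    ι (m ℕ.∸ n) + (ι n − ι n)    ≈⟨ sym (+-assoc _ _ _) ⟩
    ι (m ℕ.∸ n) + ι n − ι n      ≈⟨ +-congʳ (sym (ι-homo-+ (m ℕ.∸ n) n)) ⟩
    ι (m ℕ.∸ n ℕ.+ n) − ι n      ≈⟨ +-congʳ (reflexive (≡.cong ι (ℕₚ.m∸n+n≡m n≤m))) ⟩
    ι m − ι n                    ∎

  ιℤ-homo-‿ : ∀ i → ιℤ (ℤ.- i) ≈ - ιℤ i
  ιℤ-homo-‿ (+ zero)  = sym ε⁻¹≈ε
  ιℤ-homo-‿ (+ suc n) = refl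
  ιℤ-homo-‿ -[1+ n ]  = sym (⁻¹-involutive _)

  ιℤ-homo-⊖ : ∀ m n → ιℤ (m ⊖ n) ≈ ι m − ι n
  ιℤ-homo-⊖ m n with n ℕ.≤? m
  ... | yes n≤m = trans (reflexive (≡.cong ιℤ (ℤₚ.⊖-≥ n≤m))) (ι-homo-∸ n≤m)
  ... | no  n≰m = begin
    ιℤ (m ⊖ n)               ≈⟨ reflexive (≡.cong ιℤ (ℤₚ.⊖-≰ n≰m)) ⟩
    ιℤ (ℤ.- + (n ℕ.∸ m))     ≈⟨ ιℤ-homo-‿ (+ (n ℕ.∸ m)) ⟩
    - ι (n ℕ.∸ m)            ≈⟨ -‿cong (ι-homo-∸ (ℕₚ.≰⇒≥ n≰m)) ⟩
    - (ι n − ι m)            ≈⟨ sym (⁻¹-∙-comm _ _) ⟩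
    - ι n + - - ι m          ≈⟨ +-congˡ (⁻¹-involutive _) ⟩
    - ι n + ι m              ≈⟨ +-comm _ _ ⟩
    ι m − ι n                ∎

  ιℤ-homo-+ : ∀ i j → ιℤ (i ℤ.+ j) ≈ ιℤ i + ιℤ j
  ιℤ-homo-+ (+ m)    (+ n)    = ι-homo-+ m n
  ιℤ-homo-+ (+ m)    -[1+ n ] = ιℤ-homo-⊖ m (suc n)
  ιℤ-homo-+ -[1+ m ] (+ n)    = trans (ιℤ-homo-⊖ n (suc m)) (+-comm _ _)
  ιℤ-homo-+ -[1+ m ] -[1+ n ] = begin
    - ι (suc (suc (m ℕ.+ n)))    ≈⟨ -‿cong (reflexive (≡.cong (ι ∘ suc) (≡.sym (ℕₚ.+-suc m n)))) ⟩
    - ι (suc m ℕ.+ suc n)        ≈⟨ -‿cong (ι-homo-+ (suc m) (suc n)) ⟩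
    - (ι (suc m) + ι (suc n))    ≈⟨ sym (⁻¹-∙-comm _ _) ⟩
    - ι (suc m) + - ι (suc n)    ∎

  signed : Sign → Carrier → Carrier
  signed Sign.+ x = x
  signed Sign.- x = - x

  signed-cong : ∀ s {x y} → x ≈ y → signed s x ≈ signed s y
  signed-cong Sign.+ = id
  signed-cong Sign.- = -‿cong

  signed-* : ∀ s t x y → signed (s Sign.* t) (x * y) ≈ signed s x * signed t y
  signed-* Sign.+ Sign.+ x y = refl
  signed-* Sign.+ Sign.- x y = -‿distribʳ-* x y
  signed-* Sign.- Sign.+ x y = -‿distribˡ-* x y
  signed-* Sign.- Sign.- x y = begin
    x * y        ≈⟨ sym (⁻¹-involutive _) ⟩
    - - (x * y)  ≈⟨ -‿cong (-‿distribˡ-* x y) ⟩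
    - (- x * y)  ≈⟨ -‿distribʳ-* (- x) y ⟩
    - x * - y    ∎

  ιℤ-◃ : ∀ s n → ιℤ (s ℤ.◃ n) ≈ signed s (ι n)
  ιℤ-◃ Sign.+ zero    = refl
  ιℤ-◃ Sign.- zero    = sym ε⁻¹≈ε
  ιℤ-◃ Sign.+ (suc n) = refl
  ιℤ-◃ Sign.- (suc n) = refl

  ιℤ-signed : ∀ i → ιℤ i ≈ signed (ℤ.sign i) (ι ℤ.∣ i ∣)
  ιℤ-signed i = trans (reflexive (≡.cong ιℤ (≡.sym (ℤₚ.◃-inverse i)))) (ιℤ-◃ (ℤ.sign i) ℤ.∣ i ∣)

  ιℤ-homo-* : ∀ i j → ιℤ (i ℤ.* j) ≈ ιℤ i * ιℤ j
  ιℤ-homo-* i j = begin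
    ιℤ (s ℤ.◃ (∣ i ∣ ℕ.* ∣ j ∣))               ≈⟨ ιℤ-◃ s (∣ i ∣ ℕ.* ∣ j ∣) ⟩
    signed s (ι (∣ i ∣ ℕ.* ∣ j ∣))             ≈⟨ signed-cong s (ι-homo-* ∣ i ∣ ∣ j ∣) ⟩
    signed s (ι ∣ i ∣ * ι ∣ j ∣)               ≈⟨ signed-* (ℤ.sign i) (ℤ.sign j) _ _ ⟩
    signed (ℤ.sign i) (ι ∣ i ∣) * signed (ℤ.sign j) (ι ∣ j ∣)
                                               ≈⟨ sym (*-cong (ιℤ-signed i) (ιℤ-signed j)) ⟩
    ιℤ i * ιℤ j                                ∎
    where
    open import Data.Integer using (∣_∣)
    s : Sign
    s = ℤ.sign i Sign.* ℤ.sign j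

  -- ιℤ, except that + 1 is sent to 1# itself: the solver's constant 1 then denotes 1#.
  coefficient : ℤ → Carrier
  coefficient (+ 1) = 1#
  coefficient i     = ιℤ i

  coefficient≈ιℤ : ∀ i → coefficient i ≈ ιℤ i
  coefficient≈ιℤ (+ 0)           = refl
  coefficient≈ιℤ (+ 1)           = sym (+-identityʳ 1#)
  coefficient≈ιℤ (+ suc (suc n)) = refl
  coefficient≈ιℤ -[1+ n ]        = refl

  coefficient-homomorphism : ℤ.+-*-rawRing -Raw-AlmostCommutative⟶ fromCommutativeRing commutativeRing
  coefficient-homomorphism = record
    { ⟦_⟧    = coefficient
    ; +-homo = λ i j → trans (coefficient≈ιℤ (i ℤ.+ j))
                         (trans (ιℤ-homo-+ i j) (sym (+-cong (coefficient≈ιℤ i) (coefficient≈ιℤ j))))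
    ; *-homo = λ i j → trans (coefficient≈ιℤ (i ℤ.* j))
                         (trans (ιℤ-homo-* i j) (sym (*-cong (coefficient≈ιℤ i) (coefficient≈ιℤ j))))
    ; -‿homo = λ i → trans (coefficient≈ιℤ (ℤ.- i))
                       (trans (ιℤ-homo-‿ i) (-‿cong (sym (coefficient≈ιℤ i))))
    ; 0-homo = refl
    ; 1-homo = refl
    }

  coefficient≟ : ∀ i j → Maybe (coefficient i ≈ coefficient j)
  coefficient≟ i j with i ℤ.≟ j
  ... | yes ≡.refl = just refl
  ... | no  _      = nothing

  open import Algebra.Solver.Ring
    ℤ.+-*-rawRing (fromCommutativeRing commutativeRing) coefficient-homomorphism coefficient≟
    using (Polynomial; solve; _:=_; _:+_; _:*_; :-_; _:-_; con)

  :0 :1 : ∀ {n} → Polynomial n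
  :0 = con (+ 0)
  :1 = con (+ 1)

  *-cancelʳ : ∀ {x y} c → c ≉ 0# → x * c ≈ y * c → x ≈ y
  *-cancelʳ {x} {y} c c≉0 xc≈yc = begin
    x                ≈⟨ sym (*-identityʳ x) ⟩
    x * 1#           ≈⟨ *-congˡ (sym (inverseʳ c c≉0)) ⟩
    x * (c * c ⁻¹)   ≈⟨ sym (*-assoc _ _ _) ⟩
    x * c * c ⁻¹     ≈⟨ *-congʳ xc≈yc ⟩
    y * c * c ⁻¹     ≈⟨ *-assoc _ _ _ ⟩
    y * (c * c ⁻¹)   ≈⟨ *-congˡ (inverseʳ c c≉0) ⟩
    y * 1#           ≈⟨ *-identityʳ y ⟩
    y                ∎

  inverseˡ : ∀ x → x ≉ 0# → x ⁻¹ * x ≈ 1#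
  inverseˡ x x≉0 = trans (*-comm _ _) (inverseʳ x x≉0)

  ≉0-resp-≈ : ∀ {x y} → x ≈ y → x ≉ 0# → y ≉ 0#
  ≉0-resp-≈ x≈y x≉0 y≈0 = x≉0 (trans x≈y y≈0)

  *-≉0 : ∀ {x y} → x ≉ 0# → y ≉ 0# → x * y ≉ 0#
  *-≉0 x≉0 y≉0 xy≈0 = x≉0 (*-cancelʳ _ y≉0 (trans xy≈0 (sym (zeroˡ _))))

  x*y≉0⇒x≉0 : ∀ {x y} → x * y ≉ 0# → x ≉ 0#
  x*y≉0⇒x≉0 xy≉0 x≈0 = xy≉0 (trans (*-congʳ x≈0) (zeroˡ _))

  x*y≉0⇒y≉0 : ∀ {x y} → x * y ≉ 0# → y ≉ 0#
  x*y≉0⇒y≉0 xy≉0 y≈0 = xy≉0 (trans (*-congˡ y≈0) (zeroʳ _))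

  sgn-homo-+ : ∀ m n → sgn (m ℕ.+ n) ≈ sgn m * sgn n
  sgn-homo-+ zero    n = sym (*-identityˡ _)
  sgn-homo-+ (suc m) n = trans (-‿cong (sgn-homo-+ m n)) (-‿distribˡ-* _ _)

  sgn*sgn≈1 : ∀ n → sgn n * sgn n ≈ 1#
  sgn*sgn≈1 zero    = *-identityˡ _
  sgn*sgn≈1 (suc n) = trans (solve 1 (λ s → :- s :* :- s := s :* s) refl (sgn n)) (sgn*sgn≈1 n)

  sgn≉0 : ∀ n → sgn n ≉ 0#
  sgn≉0 n sgn≈0 = 0≉1 (begin
    0#              ≈⟨ sym (zeroˡ _) ⟩
    0# * sgn n      ≈⟨ *-congʳ (sym sgn≈0) ⟩
    sgn n * sgn n   ≈⟨ sgn*sgn≈1 n ⟩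
    1#              ∎)

  Σ≤-cong : ∀ n {f g : ℕ → Carrier} → (∀ j → f j ≈ g j) → Σ≤ n f ≈ Σ≤ n g
  Σ≤-cong zero    f≈g = f≈g 0
  Σ≤-cong (suc n) f≈g = +-cong (Σ≤-cong n f≈g) (f≈g (suc n))

  Π≤-cong : ∀ n {f g : ℕ → Carrier} → (∀ j → f j ≈ g j) → Π≤ n f ≈ Π≤ n g
  Π≤-cong zero    f≈g = f≈g 0
  Π≤-cong (suc n) f≈g = *-cong (Π≤-cong n f≈g) (f≈g (suc n))

  Σ≤-sucˡ : ∀ n f → Σ≤ (suc n) f ≈ f 0 + Σ≤ n (f ∘ suc)
  Σ≤-sucˡ zero    f = refl
  Σ≤-sucˡ (suc n) f = trans (+-congʳ (Σ≤-sucˡ n f)) (+-assoc _ _ _)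

  Σ≤-− : ∀ n f g → Σ≤ n (λ j → f j − g j) ≈ Σ≤ n f − Σ≤ n g
  Σ≤-− zero    f g = refl
  Σ≤-− (suc n) f g = trans (+-congʳ (Σ≤-− n f g))
    (solve 4 (λ a b c d → a :- b :+ (c :- d) := a :+ c :- (b :+ d)) refl _ _ _ _)

  falling-cong : ∀ n {x y} → x ≈ y → falling x n ≈ falling y n
  falling-cong zero    x≈y = refl
  falling-cong (suc n) x≈y = *-cong (falling-cong n x≈y) (+-congʳ x≈y)

  falling-sucˡ : ∀ x n → falling x (suc n) ≈ x * falling (x − 1#) n
  falling-sucˡ x zero    = solve 1 (λ x → :1 :* (x :- :0) := x :* :1) refl x
  falling-sucˡ x (suc n) = begin
    falling x (suc n) * (x − (1# + ι n))        ≈⟨ *-congʳ (falling-sucˡ x n) ⟩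
    x * falling (x − 1#) n * (x − (1# + ι n))   ≈⟨ solve 3 (λ x f m → x :* f :* (x :- (:1 :+ m))
                                                                   := x :* (f :* (x :- :1 :- m))) refl x _ (ι n) ⟩
    x * (falling (x − 1#) n * (x − 1# − ι n))   ∎

  falling-+ : ∀ x m n → falling x (m ℕ.+ n) ≈ falling x m * falling (x − ι m) n
  falling-+ x zero    n = sym (trans (*-identityˡ _) (falling-cong n (solve 1 (λ x → x :- :0 := x) refl x)))
  falling-+ x (suc m) n = begin
    falling x (suc (m ℕ.+ n))                             ≈⟨ falling-sucˡ x (m ℕ.+ n) ⟩
    x * falling (x − 1#) (m ℕ.+ n)                        ≈⟨ *-congˡ (falling-+ (x − 1#) m n) ⟩
    x * (falling (x − 1#) m * falling (x − 1# − ι m) n)   ≈⟨ sym (*-assoc _ _ _) ⟩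
    x * falling (x − 1#) m * falling (x − 1# − ι m) n     ≈⟨ *-cong (sym (falling-sucˡ x m)) (falling-cong n
                                                               (solve 2 (λ x m → x :- :1 :- m := x :- (:1 :+ m)) refl x (ι m))) ⟩
    falling x (suc m) * falling (x − ι (suc m)) n         ∎

  falling-reflect : ∀ x n → falling (x − 1#) n ≈ sgn n * falling (ι n − x) n
  falling-reflect x zero    = sym (*-identityˡ _)
  falling-reflect x (suc n) = begin
    falling (x − 1#) n * (x − 1# − ι n)
      ≈⟨ *-congʳ (falling-reflect x n) ⟩
    sgn n * falling (ι n − x) n * (x − 1# − ι n)
      ≈⟨ solve 4 (λ s f x m → s :* f :* (x :- :1 :- m) := :- s :* ((:1 :+ m :- x) :* f)) refl (sgn n) _ x (ι n) ⟩
    - sgn n * ((ι (suc n) − x) * falling (ι n − x) n)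
      ≈⟨ *-congˡ (*-congˡ (falling-cong n (solve 2 (λ m x → m :- x := :1 :+ m :- x :- :1) refl (ι n) x))) ⟩
    - sgn n * ((ι (suc n) − x) * falling (ι (suc n) − x − 1#) n)
      ≈⟨ *-congˡ (sym (falling-sucˡ _ n)) ⟩
    - sgn n * falling (ι (suc n) − x) (suc n)
      ∎

  falling≈Π≤ : ∀ x n → falling x (suc n) ≈ Π≤ n (λ m → x − ι m)
  falling≈Π≤ x zero    = *-identityˡ _
  falling≈Π≤ x (suc n) = *-congʳ (falling≈Π≤ x n)

  falling≉0 : ∀ x n → (∀ m → m < n → x − ι m ≉ 0#) → falling x n ≉ 0#
  falling≉0 x zero    _        1≈0 = 0≉1 (sym 1≈0)
  falling≉0 x (suc n) factor≉0 =
    *-≉0 (falling≉0 x n (λ m m<n → factor≉0 m (ℕₚ.m<n⇒m<1+n m<n))) (factor≉0 n ℕₚ.≤-refl)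

  -- Δ l a is the l-th forward difference of the sequence a at 0, written out in its binomial expansion.
  δ : ℕ → ℕ → Carrier
  δ l j = sgn (l ℕ.∸ j) * ι (l C j)

  Δ : ℕ → (ℕ → Carrier) → Carrier
  Δ l a = Σ≤ l (λ j → δ l j * a j)

  δ-beyond : ∀ l → δ l (suc l) ≈ 0#
  δ-beyond l = trans (*-congˡ (reflexive (≡.cong ι (k>n⇒nCk≡0 (ℕₚ.n<1+n l))))) (zeroʳ _)

  δ-suc-zero : ∀ l → δ (suc l) 0 ≈ - δ l 0
  δ-suc-zero l = sym (-‿distribˡ-* _ _)

  δ-pascal : ∀ l i → δ (suc l) (suc i) ≈ δ l i − δ l (suc i)
  δ-pascal l i = begin
    sgn (l ℕ.∸ i) * ι (suc l C suc i)
      ≈⟨ *-congˡ (reflexive (≡.cong ι (≡.sym (nCk+nC[k+1]≡[n+1]C[k+1] l i)))) ⟩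
    sgn (l ℕ.∸ i) * ι (l C i ℕ.+ l C suc i)
      ≈⟨ *-congˡ (ι-homo-+ (l C i) (l C suc i)) ⟩
    sgn (l ℕ.∸ i) * (ι (l C i) + ι (l C suc i))
      ≈⟨ distribˡ _ _ _ ⟩
    δ l i + sgn (l ℕ.∸ i) * ι (l C suc i)
      ≈⟨ +-congˡ sign-flip ⟩
    δ l i − δ l (suc i)
      ∎
    where
    sign-flip : sgn (l ℕ.∸ i) * ι (l C suc i) ≈ - δ l (suc i)
    sign-flip with suc i ℕ.≤? l
    ... | yes i<l = trans (*-congʳ (reflexive (≡.cong sgn (ℕₚ.+-∸-assoc 1 i<l)))) (sym (-‿distribˡ-* _ _))
    ... | no  i≮l rewrite k>n⇒nCk≡0 (ℕₚ.≰⇒> i≮l) = trans (zeroʳ _) (sym (trans (-‿cong (zeroʳ _)) ε⁻¹≈ε))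

  Δ-suc : ∀ l a → Δ (suc l) a ≈ Δ l (a ∘ suc) − Δ l a
  Δ-suc l a = begin
    Δ (suc l) a
      ≈⟨ Σ≤-sucˡ l _ ⟩
    δ (suc l) 0 * a 0 + Σ≤ l (λ i → δ (suc l) (suc i) * a (suc i))
      ≈⟨ +-cong (*-congʳ (δ-suc-zero l)) (Σ≤-cong l λ i → trans (*-congʳ (δ-pascal l i)) ([y-z]x≈yx-zx _ _ _)) ⟩
    - δ l 0 * a 0 + Σ≤ l (λ i → δ l i * a (suc i) − δ l (suc i) * a (suc i))
      ≈⟨ +-congˡ (Σ≤-− l _ _) ⟩
    - δ l 0 * a 0 + (Δ l (a ∘ suc) − tail)
      ≈⟨ solve 4 (λ d x s t → :- d :* x :+ (s :- t) := s :- (d :* x :+ t)) refl _ _ _ _ ⟩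
    Δ l (a ∘ suc) − (δ l 0 * a 0 + tail)
      ≈⟨ +-congˡ (-‿cong (sym Δ-head)) ⟩
    Δ l (a ∘ suc) − Δ l a
      ∎
    where
    tail : Carrier
    tail = Σ≤ l (λ i → δ l (suc i) * a (suc i))

    Δ-head : Δ l a ≈ δ l 0 * a 0 + tail
    Δ-head = begin
      Δ l a                            ≈⟨ sym (+-identityʳ _) ⟩
      Δ l a + 0#                       ≈⟨ +-congˡ (sym (trans (*-congʳ (δ-beyond l)) (zeroˡ _))) ⟩
      Σ≤ (suc l) (λ j → δ l j * a j)   ≈⟨ Σ≤-sucˡ l _ ⟩
      δ l 0 * a 0 + tail               ∎

  Δ-reciprocal-falling : ∀ k l u (a : ℕ → Carrier) →
    (∀ j → j ≤ l → a j * falling (u + ι j) (suc k) ≈ 1#) →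
    Δ l a * falling (u + ι l) (l ℕ.+ suc k) ≈ sgn l * ι (((k ℕ.+ l) C l) ℕ.* l !)
  Δ-reciprocal-falling k zero u a reciprocal = begin
    sgn 0 * ι 1 * a 0 * falling (u + ι 0) (suc k)  ≈⟨ solve 2 (λ x y → :1 :* (:1 :+ :0) :* x :* y := x :* y) refl _ _ ⟩
    a 0 * falling (u + ι 0) (suc k)                ≈⟨ reciprocal 0 z≤n ⟩
    1#                                             ≈⟨ solve 0 (:1 := :1 :* (:1 :+ :0)) refl ⟩
    sgn 0 * ι 1                                    ∎
  Δ-reciprocal-falling k (suc l) u a reciprocal = begin
    Δ (suc l) a * Q (suc l) u
      ≈⟨ *-congʳ (Δ-suc l a) ⟩
    (Δ l (a ∘ suc) − Δ l a) * Q (suc l) u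
      ≈⟨ [y-z]x≈yx-zx _ _ _ ⟩
    Δ l (a ∘ suc) * Q (suc l) u − Δ l a * Q (suc l) u
      ≈⟨ +-cong (*-congˡ Q-shifted) (-‿cong (*-congˡ Q-extended)) ⟩
    Δ l (a ∘ suc) * (Q l (u + 1#) * (u − ι k)) − Δ l a * ((u + ι (suc l)) * Q l u)
      ≈⟨ +-cong (sym (*-assoc _ _ _)) (-‿cong (x∙yz≈y∙xz _ _ _)) ⟩
    Δ l (a ∘ suc) * Q l (u + 1#) * (u − ι k) − (u + ι (suc l)) * (Δ l a * Q l u)
      ≈⟨ +-cong (*-congʳ (Δ-reciprocal-falling k l (u + 1#) (a ∘ suc) reciprocal-shifted))
                (-‿cong (*-congˡ (Δ-reciprocal-falling k l u a reciprocal-weakened))) ⟩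
    sgn l * N * (u − ι k) − (u + ι (suc l)) * (sgn l * N)
      ≈⟨ solve 5 (λ s n u k l → s :* n :* (u :- k) :- (u :+ l) :* (s :* n) := :- s :* ((k :+ l) :* n))
                 refl (sgn l) N u (ι k) (ι (suc l)) ⟩
    - sgn l * ((ι k + ι (suc l)) * N)
      ≈⟨ *-congˡ N-suc ⟩
    - sgn l * ι (((k ℕ.+ suc l) C suc l) ℕ.* suc l !)
      ∎
    where
    Q : ℕ → Carrier → Carrier
    Q l u = falling (u + ι l) (l ℕ.+ suc k)

    N : Carrier
    N = ι (((k ℕ.+ l) C l) ℕ.* l !)

    N-suc : (ι k + ι (suc l)) * N ≈ ι (((k ℕ.+ suc l) C suc l) ℕ.* suc l !)
    N-suc = begin
      (ι k + ι (suc l)) * N                              ≈⟨ *-congʳ (sym (ι-homo-+ k (suc l))) ⟩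
      ι (k ℕ.+ suc l) * N                                ≈⟨ sym (ι-homo-* (k ℕ.+ suc l) _) ⟩
      ι ((k ℕ.+ suc l) ℕ.* (((k ℕ.+ l) C l) ℕ.* l !))   ≈⟨ reflexive (≡.cong ι (≡.sym ([k+l]Cl*l!-suc k l))) ⟩
      ι (((k ℕ.+ suc l) C suc l) ℕ.* suc l !)           ∎

    Q-shifted : Q (suc l) u ≈ Q l (u + 1#) * (u − ι k)
    Q-shifted = *-cong
      (falling-cong (l ℕ.+ suc k) (solve 2 (λ u l → u :+ (:1 :+ l) := u :+ :1 :+ l) refl u (ι l)))
      (begin
        u + ι (suc l) − ι (l ℕ.+ suc k)       ≈⟨ +-congˡ (-‿cong (ι-homo-+ l (suc k))) ⟩
        u + (1# + ι l) − (ι l + (1# + ι k))   ≈⟨ solve 3 (λ u l k → u :+ (:1 :+ l) :- (l :+ (:1 :+ k)) := u :- k)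
                                                         refl u (ι l) (ι k) ⟩
        u − ι k                               ∎)

    Q-extended : Q (suc l) u ≈ (u + ι (suc l)) * Q l u
    Q-extended = trans (falling-sucˡ _ (l ℕ.+ suc k)) (*-congˡ (falling-cong (l ℕ.+ suc k)
      (solve 2 (λ u l → u :+ (:1 :+ l) :- :1 := u :+ l) refl u (ι l))))

    reciprocal-shifted : ∀ j → j ≤ l → a (suc j) * falling (u + 1# + ι j) (suc k) ≈ 1#
    reciprocal-shifted j j≤l = trans
      (*-congˡ (falling-cong (suc k) (solve 2 (λ u j → u :+ :1 :+ j := u :+ (:1 :+ j)) refl u (ι j))))
      (reciprocal (suc j) (s≤s j≤l))

    reciprocal-weakened : ∀ j → j ≤ l → a j * falling (u + ι j) (suc k) ≈ 1#
    reciprocal-weakened j j≤l = reciprocal j (ℕₚ.m≤n⇒m≤1+n j≤l)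

  module AtPoint (charZero : CharacteristicZero) (w : Carrier) (k l : ℕ) (l≤k : l ≤ k)
                 (z : Carrier) (z∈D : WithRoot.InD w k z) where
    open WithRoot w

    u Q : Carrier
    u = z + (w + w)
    Q = falling (u + ι l) (l ℕ.+ suc k)

    ι≉0 : ∀ n → .{{NonZero n}} → ι n ≉ 0#
    ι≉0 (suc n) = charZero n

    P≈falling : ∀ j → P k (z + ι j + w) ≈ falling (u + ι j) (suc k)
    P≈falling j = sym (trans (falling≈Π≤ _ k) (Π≤-cong k λ m →
      solve 4 (λ z w j m → z :+ (w :+ w) :+ j :- m := z :+ j :+ w :- m :+ w) refl z w (ι j) (ι m)))

    P≉0 : ∀ j → j ≤ l → P k (z + ι j + w) ≉ 0#
    P≉0 j j≤l = ≉0-resp-≈ (sym (P≈falling j)) (falling≉0 _ (suc k) factor≉0)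
      where
      factor≉0 : ∀ m → m < suc k → u + ι j − ι m ≉ 0#
      factor≉0 m (s≤s m≤k) factor≈0 = z∈D (m ⊖ j) (-[k]≤m⊖n m (ℕₚ.≤-trans j≤l l≤k)) (m⊖n≤k j m≤k) (begin
        z                                         ≈⟨ solve 4 (λ z w j m → z := z :+ (w :+ w) :+ j :- m :+ (m :- j :- (w :+ w)))
                                                               refl z w (ι j) (ι m) ⟩
        (u + ι j − ι m) + (ι m − ι j − (w + w))   ≈⟨ +-congʳ factor≈0 ⟩
        0# + (ι m − ι j − (w + w))                ≈⟨ +-identityˡ _ ⟩
        ι m − ι j − (w + w)                       ≈⟨ +-congʳ (sym (ιℤ-homo-⊖ m j)) ⟩
        ιℤ (m ⊖ j) − (w + w)                      ∎)

    ΔQ≈ : Δ l (λ j → P k (z + ι j + w) ⁻¹) * Q ≈ sgn l * ι (((k ℕ.+ l) C l) ℕ.* l !)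
    ΔQ≈ = Δ-reciprocal-falling k l u _ λ j j≤l →
      trans (*-congˡ (sym (P≈falling j))) (inverseˡ _ (P≉0 j j≤l))

    -- Rather than checking its factors one by one, Q ≉ 0 is read off ΔQ≈.
    Q≉0 : Q ≉ 0#
    Q≉0 Q≈0 = *-≉0 (sgn≉0 l) [k+l]Cl*l!≉0 (trans (sym ΔQ≈) (trans (*-congˡ Q≈0) (zeroʳ _)))
      where
      [k+l]Cl*l!≉0 : ι (((k ℕ.+ l) C l) ℕ.* l !) ≉ 0#
      [k+l]Cl*l!≉0 = x*y≉0⇒x≉0 (≉0-resp-≈
        (trans (reflexive (≡.cong ι (≡.sym ([k+l]Cl*l!*k!≡[k+l]! k l)))) (ι-homo-* (((k ℕ.+ l) C l) ℕ.* l !) (k !)))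
        (ι≉0 ((k ℕ.+ l) !) {{ℕₚ._!≢0 (k ℕ.+ l)}}))

    F₁ F₂ : Carrier
    F₁ = falling (ι k − (w + w) − z) k
    F₂ = falling (ι l + (w + w) + z) l

    Q≈ : Q ≈ sgn k * (u * (F₁ * F₂))
    Q≈ = begin
      falling (u + ι l) (l ℕ.+ suc k)
        ≈⟨ falling-+ _ l (suc k) ⟩
      falling (u + ι l) l * falling (u + ι l − ι l) (suc k)
        ≈⟨ *-cong (falling-cong l (solve 3 (λ z w l → z :+ (w :+ w) :+ l := l :+ (w :+ w) :+ z) refl z w (ι l)))
                  (falling-cong (suc k) (solve 2 (λ u l → u :+ l :- l := u) refl u (ι l))) ⟩
      F₂ * falling u (suc k)
        ≈⟨ *-congˡ (falling-sucˡ u k) ⟩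
      F₂ * (u * falling (u − 1#) k)
        ≈⟨ *-congˡ (*-congˡ (falling-reflect u k)) ⟩
      F₂ * (u * (sgn k * falling (ι k − u) k))
        ≈⟨ *-congˡ (*-congˡ (*-congˡ (falling-cong k
             (solve 3 (λ k z w → k :- (z :+ (w :+ w)) := k :- (w :+ w) :- z) refl (ι k) z w)))) ⟩
      F₂ * (u * (sgn k * F₁))
        ≈⟨ solve 4 (λ f₂ u s f₁ → f₂ :* (u :* (s :* f₁)) := s :* (u :* (f₁ :* f₂))) refl F₂ u (sgn k) F₁ ⟩
      sgn k * (u * (F₁ * F₂))
        ∎

    R*Q≈ : R k l z * Q ≈ sgn l * ι ((k ℕ.+ l) C l)
    R*Q≈ = begin
      L ⁻¹ * Δ l _ * Q                 ≈⟨ *-assoc _ _ _ ⟩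
      L ⁻¹ * (Δ l _ * Q)               ≈⟨ *-congˡ (trans ΔQ≈ (*-congˡ (ι-homo-* ((k ℕ.+ l) C l) (l !)))) ⟩
      L ⁻¹ * (sgn l * (c * L))         ≈⟨ solve 4 (λ i s c x → i :* (s :* (c :* x)) := s :* c :* (i :* x))
                                                   refl (L ⁻¹) (sgn l) c L ⟩
      sgn l * c * (L ⁻¹ * L)           ≈⟨ *-congˡ (inverseˡ L (ι≉0 (l !) {{ℕₚ._!≢0 l}})) ⟩
      sgn l * c * 1#                   ≈⟨ *-identityʳ _ ⟩
      sgn l * c                        ∎
      where
      c L : Carrier
      c = ι ((k ℕ.+ l) C l)
      L = ι (l !)

    RHS*Q≈ : RHS k l z * Q ≈ sgn l * ι ((k ℕ.+ l) C l)
    RHS*Q≈ = begin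
      sgn (k ℕ.+ l) * c * u ⁻¹ * FF ⁻¹ * Q
        ≈⟨ *-congˡ Q≈ ⟩
      sgn (k ℕ.+ l) * c * u ⁻¹ * FF ⁻¹ * (sgn k * (u * FF))
        ≈⟨ solve 7 (λ t c u⁻ f⁻ s u f → t :* c :* u⁻ :* f⁻ :* (s :* (u :* f)) := t :* s :* c :* (u⁻ :* u :* (f⁻ :* f)))
                   refl _ _ _ _ _ _ _ ⟩
      sgn (k ℕ.+ l) * sgn k * c * (u ⁻¹ * u * (FF ⁻¹ * FF))
        ≈⟨ *-cong (*-congʳ (*-congʳ (sgn-homo-+ k l)))
                  (*-cong (inverseˡ u (x*y≉0⇒x≉0 uFF≉0)) (inverseˡ FF (x*y≉0⇒y≉0 uFF≉0))) ⟩
      sgn k * sgn l * sgn k * c * (1# * 1#)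
        ≈⟨ solve 3 (λ s t c → s :* t :* s :* c :* (:1 :* :1) := t :* c :* (s :* s)) refl (sgn k) (sgn l) c ⟩
      sgn l * c * (sgn k * sgn k)
        ≈⟨ *-congˡ (sgn*sgn≈1 k) ⟩
      sgn l * c * 1#
        ≈⟨ *-identityʳ _ ⟩
      sgn l * c
        ∎
      where
      c FF : Carrier
      c  = ι ((k ℕ.+ l) C l)
      FF = F₁ * F₂

      uFF≉0 : u * FF ≉ 0#
      uFF≉0 = x*y≉0⇒y≉0 (≉0-resp-≈ Q≈ Q≉0)

proposition2p8 : ∀ {a b : Level} (F : Field a b) →
  let open Field F
      open FieldOps F
  in CharacteristicZero →
     ∀ (c : ℕ) → NonZero c →
     ∀ (w : Carrier) → w * w ≈ - ι c →
     let open WithRoot w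
     in ∀ (k l : ℕ) → l ≤ k →
        ∀ (z : Carrier) → InD k z →
        R k l z ≈ RHS k l z
proposition2p8 F charZero _ _ w _ k l l≤k z z∈D = *-cancelʳ F Q Q≉0 (trans R*Q≈ (sym RHS*Q≈))
  where
  open Field F using (trans; sym)
  open AtPoint F charZero w k l l≤k z z∈D
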